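{- Let $\mathfrak{A}=(A;=,+,V_2)$ be a non-standard model of $\mathrm{BA}_2$ and let $c\in A$ be non-standard with $V_2(c)=c$ such that $c-1$ is divisible in $\mathfrak{A}$ by every standard odd natural number. Let $q$ be a positive rational that is not of the form $m\cdot 2^k$ with $m,k\in\mathbb{Z}$ (i.e., not a binary rational), written in lowest terms as $q=a/b$ with $a,b$ positive integers. Then no element $x\in A$ such that $\underline{b}x$ and $\underline{a}c$ lie in the same galaxy is a hypernumber.
   Context: $\mathrm{BA}_2=\mathrm{Th}(\mathbb{N};=,+,V_2)$, where $V_2(x)$ is the largest power of $2$ dividing $x$ for $x\neq0$ and $V_2(0)=0$. Standard elements are $0,1,1+1,\ldots$; others are non-standard. $\underline{m}y$ denotes $y+\cdots+y$ ($m$ times). For non-standard $u,v$, $u\sim v$ iff the difference between $u$ and $v$ is a standard natural number; the galaxy of $u$ is its $\sim$-class. A non-standard $x$ is a hypernumber if $V_2(x)$ is non-standard. -}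

module Defs where

open import Data.Nat using (ℕ; zero; suc; _+_; _*_; _^_; _/_; _%_; _≟_)
open import Data.Nat.Coprimality using (Coprime)
open import Data.Integer as ℤ using (ℤ; +_)
open import Data.Fin using (Fin)
open import Data.Product using (Σ; ∃; _×_; _,_)
open import Data.Sum using (_⊎_)
open import Data.Empty using (⊥)
open import Relation.Nullary using (¬_; yes; no)
open import Relation.Binary.PropositionalEquality using (_≡_)

-- The 2-adic valuation function V₂ on ℕ (largest power of 2 dividing x,
-- V₂ 0 = 0).  Defined with fuel; fuel x suffices since x/2 < x.

v2-go : ℕ → ℕ → ℕ
v2-go zero    n = 0
v2-go (suc f) n with n ≟ 0
... | yes _ = 0
... | no  _ with n % 2 ≟ 0
...   | yes _ = 2 * v2-go f (n / 2)
...   | no  _ = 1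

V₂ : ℕ → ℕ
V₂ n = v2-go n n

data Term (n : ℕ) : Set where
  var  : Fin n → Term n
  _⊕_  : Term n → Term n → Term n
  vv   : Term n → Term n

-- Formulas in the (classically complete) connective basis ¬, ∧, ∀.
data Formula : ℕ → Set where
  _≐_   : ∀ {n} → Term n → Term n → Formula n
  ¬'_   : ∀ {n} → Formula n → Formula n
  _∧'_  : ∀ {n} → Formula n → Formula n → Formula n
  ∀'_   : ∀ {n} → Formula (suc n) → Formula n

record Structure : Set₁ where
  field
    Carrier : Set
    _+ᴬ_    : Carrier → Carrier → Carrier
    Vᴬ      : Carrier → Carrier

open Structure public

extend : ∀ {n} {A : Set} → (Fin n → A) → A → Fin (suc n) → A
extend ρ a Fin.zero    = a
extend ρ a (Fin.suc i) = ρ i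

evalT : ∀ {n} (M : Structure) → (Fin n → Carrier M) → Term n → Carrier M
evalT M ρ (var i) = ρ i
evalT M ρ (s ⊕ t) = _+ᴬ_ M (evalT M ρ s) (evalT M ρ t)
evalT M ρ (vv t)  = Vᴬ M (evalT M ρ t)

Sat : ∀ {n} (M : Structure) → (Fin n → Carrier M) → Formula n → Set
Sat M ρ (s ≐ t)  = evalT M ρ s ≡ evalT M ρ t
Sat M ρ (¬' φ)   = ¬ Sat M ρ φ
Sat M ρ (φ ∧' ψ) = Sat M ρ φ × Sat M ρ ψ
Sat M ρ (∀' φ)   = (a : Carrier M) → Sat M (extend ρ a) φ

noEnv : ∀ {A : Set} → Fin 0 → A
noEnv ()

ℕ-str : Structure
ℕ-str = record { Carrier = ℕ ; _+ᴬ_ = _+_ ; Vᴬ = V₂ }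

ModelBA₂ : Structure → Set
ModelBA₂ M = (φ : Formula 0) → Sat ℕ-str noEnv φ → Sat M noEnv φ

module _ (M : Structure) where
  private
    A = Carrier M
    _⊹_ = _+ᴬ_ M

  -- z is the element 0 of M (the unique x with x + x = x).
  IsZero : A → Set
  IsZero z = z ⊹ z ≡ z

  IsOne : A → Set
  IsOne o = (¬ IsZero o) × (∀ y w → y ⊹ w ≡ o → IsZero y ⊎ IsZero w)

  times : A → ℕ → A → A
  times z zero y          = z
  times z (suc zero) y    = y
  times z (suc (suc m)) y = y ⊹ times z (suc m) y

  num : A → A → ℕ → A
  num z o n = times z n o

  Standard : A → A → A → Set
  Standard z o x = ∃ λ n → x ≡ num z o n

  NonStandardModel : Set
  NonStandardModel = ∀ z o → IsZero z → IsOne o → ∃ λ x → ¬ Standard z o x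

  SameGalaxy : A → A → A → A → Set
  SameGalaxy z o u v = ∃ λ n → (u ⊹ num z o n ≡ v) ⊎ (v ⊹ num z o n ≡ u)

  Hypernumber : A → A → A → Set
  Hypernumber z o x = (¬ Standard z o x) × (¬ Standard z o (Vᴬ M x))

  DivisibleBy : A → ℕ → A → Set
  DivisibleBy z m d = ∃ λ y → times z m y ≡ d

-- a/b (a, b positive) is a binary rational: a/b = m·2^k with m, k ∈ ℤ.
-- Writing k = i - j with i, j ∈ ℕ, this is  a·2^j = m·2^i·b  in ℤ.

IsBinaryRational : ℕ → ℕ → Set
IsBinaryRational a b =
  Σ ℤ λ m → ∃ λ i → ∃ λ j → (+ (a * 2 ^ j)) ≡ m ℤ.* (+ (2 ^ i * b))

-- Fix the distance n between b·x and a·c. Consider the first-order sentence saying that there are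
-- no z, o, c, x with z = 0, o = 1, V₂(c) = c ∉ {0,…,2ⁿ−1}, V₂(x) ∉ {0,…,2ⁿ−1}, b·x and a·c at
-- distance n, and c − 1 divisible by m, where m > 1 is an odd divisor of b (it exists because
-- a/b is not a binary rational). The sentence is true in ℕ: there 2ⁿ divides both b·x and a·c,
-- so their distance n < 2ⁿ is 0; then every common divisor of b and c − 1 divides a, so m = 1.
-- Hence it is true in 𝔄, where c and a hypernumber x would violate it.
module Submission where

open import Defs
open import Data.Nat using (ℕ; zero; suc; _+_; _*_; _^_; _/_; _%_; _≟_; _≤_; _<_; _≥_; z≤n; s≤s)
open import Data.Nat.Properties
open import Data.Nat.Divisibility
  using (_∣_; divides; _∣?_; 1∣_; ∣⇒≤; ∣m+n∣m⇒∣n; ∣m⇒∣m*n; ∣n⇒∣m*n; m%n≡0⇒n∣m; m∣n/o⇒o*m∣n)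
open import Data.Nat.Induction using (<-wellFounded)
open import Data.Nat.Coprimality using (Coprime)
import Data.Integer as ℤ
open import Data.Integer.Properties using (pos-*)
open import Data.Fin using (Fin; #_) renaming (zero to fzero; suc to fsuc)
open import Data.Product using (∃; ∃₂; _,_)
open import Data.Sum using (_⊎_; inj₁; inj₂; [_,_])
open import Data.Empty using (⊥-elim)
open import Function using (_∘_)
open import Induction.WellFounded using (Acc; acc)
open import Relation.Nullary using (¬_; yes; no)
open import Relation.Nullary.Decidable using (decidable-stable; _⊎-dec_)
open import Relation.Binary.PropositionalEquality hiding ([_])

open ≡-Reasoning

m+m≡m⇒m≡0 : ∀ m → m + m ≡ m → m ≡ 0
m+m≡m⇒m≡0 m e = +-cancelˡ-≡ m m 0 (trans e (sym (+-identityʳ m)))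

n<2^n : ∀ n → n < 2 ^ n
n<2^n zero    = s≤s z≤n
n<2^n (suc n) =
  subst (suc (suc n) ≤_) (cong (2 ^ n +_) (sym (+-identityʳ (2 ^ n))))
        (+-mono-≤ (m^n>0 2 n) (n<2^n n))

2^n∣n⇒n≡0 : ∀ n → 2 ^ n ∣ n → n ≡ 0
2^n∣n⇒n≡0 zero    _   = refl
2^n∣n⇒n≡0 (suc n) div = ⊥-elim (<⇒≱ (n<2^n (suc n)) (∣⇒≤ div))

multiples-of-2^n-at-distance-n : ∀ {n u v} → 2 ^ n ∣ u → 2 ^ n ∣ v → u + n ≡ v → u ≡ v
multiples-of-2^n-at-distance-n {n} {u} 2ⁿ∣u 2ⁿ∣v u+n≡v = begin
  u      ≡⟨ +-identityʳ u ⟨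
  u + 0  ≡⟨ cong (u +_) n≡0 ⟨
  u + n  ≡⟨ u+n≡v ⟩
  _      ∎
  where n≡0 = 2^n∣n⇒n≡0 n (∣m+n∣m⇒∣n (subst (2 ^ n ∣_) (sym u+n≡v) 2ⁿ∣v) 2ⁿ∣u)

-- No hypothesis on u or the fuel: in the degenerate cases v2-go returns 0.
2^m≤v2-go⇒2^m∣ : ∀ fuel u m → 2 ^ m ≤ v2-go fuel u → 2 ^ m ∣ u
2^m≤v2-go⇒2^m∣ zero u m le = ⊥-elim (<⇒≱ (m^n>0 2 m) le)
2^m≤v2-go⇒2^m∣ (suc fuel) u m le with u ≟ 0
... | yes _ = ⊥-elim (<⇒≱ (m^n>0 2 m) le)
... | no _ with u % 2 ≟ 0
2^m≤v2-go⇒2^m∣ (suc fuel) u zero    le | no _ | yes _    = 1∣ u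
2^m≤v2-go⇒2^m∣ (suc fuel) u (suc m) le | no _ | yes even =
  m∣n/o⇒o*m∣n (m%n≡0⇒n∣m u 2 even) (2^m≤v2-go⇒2^m∣ fuel (u / 2) m (*-cancelˡ-≤ 2 le))
2^m≤v2-go⇒2^m∣ (suc fuel) u zero    le | no _ | no _     = 1∣ u
2^m≤v2-go⇒2^m∣ (suc fuel) u (suc m) le | no _ | no _     =
  ⊥-elim (<⇒≱ (*-monoʳ-≤ 2 (m^n>0 2 m)) le)

2^m≤V₂⇒2^m∣ : ∀ m u → 2 ^ m ≤ V₂ u → 2 ^ m ∣ u
2^m≤V₂⇒2^m∣ m u = 2^m≤v2-go⇒2^m∣ u u m

even-or-odd : ∀ n → (∃ λ h → n ≡ 2 * h) ⊎ (∃ λ h → n ≡ suc (2 * h))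
even-or-odd zero    = inj₁ (0 , refl)
even-or-odd (suc n) with even-or-odd n
... | inj₁ (h , refl) = inj₂ (h , refl)
... | inj₂ (h , refl) = inj₁ (suc h , cong suc (sym (+-suc h (h + 0))))

suc≡2^j*odd : ∀ n → Acc _<_ n → ∃₂ λ j k → suc n ≡ 2 ^ j * suc (2 * k)
suc≡2^j*odd n (acc rec) with even-or-odd n
... | inj₁ (h , refl) = 0 , h , sym (+-identityʳ _)
... | inj₂ (h , refl) with suc≡2^j*odd h (rec (s≤s (m≤m+n h (h + 0))))
...   | j , k , h+1≡ = suc j , k , (begin
  suc (suc (2 * h))        ≡⟨ cong suc (+-suc h (h + 0)) ⟨
  2 * suc h                ≡⟨ cong (2 *_) h+1≡ ⟩
  2 * (2 ^ j * suc (2 * k)) ≡⟨ *-assoc 2 (2 ^ j) _ ⟨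
  2 ^ suc j * suc (2 * k)  ∎)

¬IsBinaryRational⇒odd-divisor : ∀ {a b} → b ≥ 1 → ¬ IsBinaryRational a b →
  ∃ λ k → suc (2 * suc k) ∣ b
¬IsBinaryRational⇒odd-divisor {a} {suc b₀} _ ¬binary with suc≡2^j*odd b₀ (<-wellFounded b₀)
... | j , suc k , b≡ = k , divides (2 ^ j) b≡
... | j , zero  , b≡ = ⊥-elim (¬binary (ℤ.+ a , 0 , j , (begin
  ℤ.+ (a * 2 ^ j)        ≡⟨ cong (ℤ.+_ ∘ (a *_)) (trans (sym (*-identityʳ (2 ^ j))) (sym b≡)) ⟩
  ℤ.+ (a * suc b₀)       ≡⟨ cong (ℤ.+_ ∘ (a *_)) (+-identityʳ (suc b₀)) ⟨
  ℤ.+ (a * (1 * suc b₀)) ≡⟨ pos-* a (1 * suc b₀) ⟩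
  ℤ.+ a ℤ.* ℤ.+ (1 * suc b₀) ∎)))

b*x≡a*[1+d]⇒Coprime[b,d] : ∀ {a b d x} → Coprime a b → b * x ≡ a * suc d → Coprime b d
b*x≡a*[1+d]⇒Coprime[b,d] {a} {b} {d} {x} cop bx≡ {i} (i∣b , i∣d) = cop (i∣a , i∣b)
  where
    i∣a : i ∣ a
    i∣a = ∣m+n∣m⇒∣n (subst (i ∣_) (trans bx≡ (trans (*-suc a d) (+-comm a (a * d))))
                                (∣m⇒∣m*n x i∣b))
                    (∣n⇒∣m*n a i∣d)

no-near-cross-multiples : ∀ {a b m n c x} → Coprime a b → m ∣ b → m ≢ 1 →
  V₂ c ≡ c → 2 ^ n ≤ c → 2 ^ n ≤ V₂ x → (∀ d → suc d ≡ c → m ∣ d) →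
  ¬ ((b * x + n ≡ a * c) ⊎ (a * c + n ≡ b * x))
no-near-cross-multiples {n = n} {c = zero} _ _ _ _ c≥2ⁿ _ _ _ = <⇒≱ (m^n>0 2 n) c≥2ⁿ
no-near-cross-multiples {a} {b} {m} {n} {suc d} {x} cop m∣b m≢1 V₂c≡c c≥2ⁿ V₂x≥2ⁿ m∣c-1 near =
  m≢1 (b*x≡a*[1+d]⇒Coprime[b,d] cop bx≡ac (m∣b , m∣c-1 d refl))
  where
    2ⁿ∣bx : 2 ^ n ∣ b * x
    2ⁿ∣bx = ∣n⇒∣m*n b (2^m≤V₂⇒2^m∣ n x V₂x≥2ⁿ)
    2ⁿ∣ac : 2 ^ n ∣ a * suc d
    2ⁿ∣ac = ∣n⇒∣m*n a (2^m≤V₂⇒2^m∣ n (suc d) (subst (2 ^ n ≤_) (sym V₂c≡c) c≥2ⁿ))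
    bx≡ac : b * x ≡ a * suc d
    bx≡ac = [ multiples-of-2^n-at-distance-n 2ⁿ∣bx 2ⁿ∣ac
            , sym ∘ multiples-of-2^n-at-distance-n 2ⁿ∣ac 2ⁿ∣bx ] near

-- The language has no constants, so formulas receive the variables standing for 0 and 1 (z, o).

timesT : ∀ {n} → Fin n → ℕ → Term n → Term n
timesT z zero          t = var z
timesT z (suc zero)    t = t
timesT z (suc (suc m)) t = t ⊕ timesT z (suc m) t

numT : ∀ {n} → Fin n → Fin n → ℕ → Term n
numT z o i = timesT z i (var o)

_∨'_ : ∀ {n} → Formula n → Formula n → Formula n
φ ∨' ψ = ¬' ((¬' φ) ∧' (¬' ψ))

IsZeroF : ∀ {n} → Fin n → Formula n
IsZeroF i = (var i ⊕ var i) ≐ var i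

IsOneF : ∀ {n} → Fin n → Formula n
IsOneF i = (¬' IsZeroF i) ∧'
  (∀' ∀' ¬' (((var (# 1) ⊕ var (# 0)) ≐ var (fsuc (fsuc i))) ∧' ((¬' IsZeroF (# 1)) ∧' (¬' IsZeroF (# 0)))))

DivisibleF : ∀ {n} → Fin n → ℕ → Fin n → Formula n
DivisibleF z m d = ¬' ∀' ¬' (timesT (fsuc z) m (var fzero) ≐ var (fsuc d))

PredDivisibleF : ∀ {n} → Fin n → Fin n → ℕ → Fin n → Formula n
PredDivisibleF z o m c =
  ∀' ¬' (((var fzero ⊕ var (fsuc o)) ≐ var (fsuc c)) ∧' (¬' DivisibleF (fsuc z) m fzero))

NotBelowF : ∀ {n} → Fin n → Fin n → ℕ → Term n → Formula n
NotBelowF z o zero    t = t ≐ t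
NotBelowF z o (suc N) t = NotBelowF z o N t ∧' (¬' (t ≐ numT z o N))

NearF : ∀ {n} → Fin n → Fin n → ℕ → Term n → Term n → Formula n
NearF z o n u v = ((u ⊕ numT z o n) ≐ v) ∨' ((v ⊕ numT z o n) ≐ u)

module _ (M : Structure) where
  private
    _⊹_ = _+ᴬ_ M
    variable
      k : ℕ
      ρ : Fin k → Carrier M

  evalT-timesT : ∀ {z} m {t} → evalT M ρ (timesT z m t) ≡ times M (ρ z) m (evalT M ρ t)
  evalT-timesT zero          = refl
  evalT-timesT (suc zero)    = refl
  evalT-timesT (suc (suc m)) = cong (_ ⊹_) (evalT-timesT (suc m))

  sat-IsOneF : ∀ {i} → IsOne M (ρ i) → Sat M ρ (IsOneF i)
  sat-IsOneF (o≢0 , indecomposable) =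
    o≢0 , λ y w (y+w≡o , y≢0 , w≢0) → [ y≢0 , w≢0 ] (indecomposable y w y+w≡o)

  sat-DivisibleF : ∀ {z m d} → DivisibleBy M (ρ z) m (ρ d) → Sat M ρ (DivisibleF z m d)
  sat-DivisibleF {m = m} (y , my≡d) ¬divisible = ¬divisible y (trans (evalT-timesT m) my≡d)

  sat-PredDivisibleF : ∀ {z o m c} → (∀ d → d ⊹ ρ o ≡ ρ c → DivisibleBy M (ρ z) m d) →
    Sat M ρ (PredDivisibleF z o m c)
  sat-PredDivisibleF {ρ = ρ} {z} {m = m} m∣c-1 d (d+o≡c , ¬divisible) =
    ¬divisible (sat-DivisibleF {ρ = extend ρ d} {fsuc z} {m} {fzero} (m∣c-1 d d+o≡c))

  sat-NotBelowF : ∀ {z o} N {t} → ¬ Standard M (ρ z) (ρ o) (evalT M ρ t) →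
    Sat M ρ (NotBelowF z o N t)
  sat-NotBelowF zero    _      = refl
  sat-NotBelowF (suc N) nonstd =
    sat-NotBelowF N nonstd , λ t≡N → nonstd (N , trans t≡N (evalT-timesT N))

  sat-NearF : ∀ {z o} n u v {u′ v′} → evalT M ρ u ≡ u′ → evalT M ρ v ≡ v′ →
    (u′ ⊹ num M (ρ z) (ρ o) n ≡ v′) ⊎ (v′ ⊹ num M (ρ z) (ρ o) n ≡ u′) → Sat M ρ (NearF z o n u v)
  sat-NearF n _ _ refl refl (inj₁ e) (¬near , _) = ¬near (trans (cong (_ ⊹_) (evalT-timesT n)) e)
  sat-NearF n _ _ refl refl (inj₂ e) (_ , ¬near) = ¬near (trans (cong (_ ⊹_) (evalT-timesT n)) e)

module _ where
  private
    variable
      k : ℕ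
      ρ : Fin k → ℕ

  times-ℕ : ∀ m y → times ℕ-str 0 m y ≡ m * y
  times-ℕ zero          y = refl
  times-ℕ (suc zero)    y = sym (+-identityʳ y)
  times-ℕ (suc (suc m)) y = cong (y +_) (times-ℕ (suc m) y)

  evalT-timesT-ℕ : ∀ {z} m {t} → ρ z ≡ 0 → evalT ℕ-str ρ (timesT z m t) ≡ m * evalT ℕ-str ρ t
  evalT-timesT-ℕ {ρ = ρ} m {t} z≡0 = trans (evalT-timesT ℕ-str m)
    (trans (cong (λ w → times ℕ-str w m (evalT ℕ-str ρ t)) z≡0) (times-ℕ m (evalT ℕ-str ρ t)))

  evalT-numT-ℕ : ∀ {z o} i → ρ z ≡ 0 → ρ o ≡ 1 → evalT ℕ-str ρ (numT z o i) ≡ i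
  evalT-numT-ℕ i z≡0 o≡1 =
    trans (evalT-timesT-ℕ i z≡0) (trans (cong (i *_) o≡1) (*-identityʳ i))

  IsOneF-ℕ : ∀ {i} → Sat ℕ-str ρ (IsOneF i) → ρ i ≡ 1
  IsOneF-ℕ {ρ = ρ} {i} (o≢0 , indecomposable) with ρ i
  ... | zero        = ⊥-elim (o≢0 refl)
  ... | suc zero    = refl
  ... | suc (suc m) =
    ⊥-elim (indecomposable 1 (suc m) (refl , (λ ()) , (λ ()) ∘ m+m≡m⇒m≡0 (suc m)))

  DivisibleF-ℕ : ∀ {z m d} → ρ z ≡ 0 → Sat ℕ-str ρ (DivisibleF z m d) → m ∣ ρ d
  DivisibleF-ℕ {ρ = ρ} {m = m} {d} z≡0 ¬¬divisible = decidable-stable (m ∣? ρ d) λ m∤d →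
    ¬¬divisible λ y my≡d →
      m∤d (divides y (trans (sym my≡d) (trans (evalT-timesT-ℕ m z≡0) (*-comm m y))))

  PredDivisibleF-ℕ : ∀ {z o m c} → ρ z ≡ 0 → ρ o ≡ 1 → Sat ℕ-str ρ (PredDivisibleF z o m c) →
    ∀ d → suc d ≡ ρ c → m ∣ d
  PredDivisibleF-ℕ {ρ = ρ} {z} {m = m} z≡0 o≡1 sat d 1+d≡c = decidable-stable (m ∣? d) λ m∤d →
    sat d ( trans (cong (d +_) o≡1) (trans (+-comm d 1) 1+d≡c)
          , m∤d ∘ DivisibleF-ℕ {ρ = extend ρ d} {fsuc z} {d = fzero} z≡0)

  NotBelowF-ℕ : ∀ {z o} N {t} → ρ z ≡ 0 → ρ o ≡ 1 → Sat ℕ-str ρ (NotBelowF z o N t) →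
    N ≤ evalT ℕ-str ρ t
  NotBelowF-ℕ zero    _   _   _                = z≤n
  NotBelowF-ℕ (suc N) z≡0 o≡1 (notBelow , t≢N) =
    ≤∧≢⇒< (NotBelowF-ℕ N z≡0 o≡1 notBelow)
          λ N≡t → t≢N (trans (sym N≡t) (sym (evalT-numT-ℕ N z≡0 o≡1)))

  NearF-ℕ : ∀ {z o} n u v {u′ v′} → ρ z ≡ 0 → ρ o ≡ 1 →
    evalT ℕ-str ρ u ≡ u′ → evalT ℕ-str ρ v ≡ v′ → Sat ℕ-str ρ (NearF z o n u v) → (u′ + n ≡ v′) ⊎ (v′ + n ≡ u′)
  NearF-ℕ n _ _ {u′} {v′} z≡0 o≡1 refl refl near =
    decidable-stable ((u′ + n ≟ v′) ⊎-dec (v′ + n ≟ u′)) λ far →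
      near ( (λ e → far (inj₁ (trans (cong (u′ +_) (sym (evalT-numT-ℕ n z≡0 o≡1))) e)))
           , (λ e → far (inj₂ (trans (cong (v′ +_) (sym (evalT-numT-ℕ n z≡0 o≡1))) e))))

env₄ : {A : Set} → A → A → A → A → Fin 4 → A
env₄ z o c x = extend (extend (extend (extend noEnv z) o) c) x

xᵥ cᵥ oᵥ zᵥ : Fin 4
xᵥ = # 0
cᵥ = # 1
oᵥ = # 2
zᵥ = # 3

HyperSolutionF : ℕ → ℕ → ℕ → ℕ → Formula 4
HyperSolutionF a b m n =
  IsZeroF zᵥ ∧' (IsOneF oᵥ ∧' ((vv (var cᵥ) ≐ var cᵥ) ∧'
  (NotBelowF zᵥ oᵥ (2 ^ n) (var cᵥ) ∧' (NotBelowF zᵥ oᵥ (2 ^ n) (vv (var xᵥ)) ∧'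
  (NearF zᵥ oᵥ n (timesT zᵥ b (var xᵥ)) (timesT zᵥ a (var cᵥ)) ∧' PredDivisibleF zᵥ oᵥ m cᵥ)))))

NoHyperSolution : ℕ → ℕ → ℕ → ℕ → Formula 0
NoHyperSolution a b m n = ∀' ∀' ∀' ∀' ¬' HyperSolutionF a b m n

ℕ⊨NoHyperSolution : ∀ {a b m} → Coprime a b → m ∣ b → m ≢ 1 → ∀ n →
  Sat ℕ-str noEnv (NoHyperSolution a b m n)
ℕ⊨NoHyperSolution {a} {b} {m} cop m∣b m≢1 n z o c x
  (z-zero , o-one , V₂c≡c , c-large , V₂x-large , near , m∣c-1)
  with m+m≡m⇒m≡0 z z-zero | IsOneF-ℕ {ρ = env₄ z o c x} {oᵥ} o-one
... | refl | refl =
  no-near-cross-multiples cop m∣b m≢1 V₂c≡c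
    (NotBelowF-ℕ (2 ^ n) refl refl c-large) (NotBelowF-ℕ (2 ^ n) refl refl V₂x-large)
    (PredDivisibleF-ℕ {z = zᵥ} {oᵥ} {m} {cᵥ} refl refl m∣c-1)
    (NearF-ℕ n (timesT zᵥ b (var xᵥ)) (timesT zᵥ a (var cᵥ)) refl refl
      (evalT-timesT-ℕ b refl) (evalT-timesT-ℕ a refl) near)

mainTheorem7 : (M : Structure) → ModelBA₂ M → NonStandardModel M →
    (z o : Carrier M) → IsZero M z → IsOne M o →
    (c : Carrier M) → ¬ Standard M z o c → Vᴬ M c ≡ c →
    (∀ d → _+ᴬ_ M d o ≡ c → ∀ k → DivisibleBy M z (suc (2 * k)) d) →
    (a b : ℕ) → a ≥ 1 → b ≥ 1 → Coprime a b → ¬ IsBinaryRational a b →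
    (x : Carrier M) → SameGalaxy M z o (times M z b x) (times M z a c) →
    ¬ Hypernumber M z o x
mainTheorem7 M model _ z o z-zero o-one c c-nonstd V₂c≡c c-1-odd-divisible a b _ b≥1 cop ¬binary
  x (n , near) (_ , V₂x-nonstd)
  with ¬IsBinaryRational⇒odd-divisor {a} b≥1 ¬binary
... | k , m∣b =
  model (NoHyperSolution a b m n) (ℕ⊨NoHyperSolution cop m∣b (λ ()) n) z o c x
    ( z-zero , sat-IsOneF M {ρ = env₄ z o c x} {oᵥ} o-one , V₂c≡c
    , sat-NotBelowF M (2 ^ n) c-nonstd , sat-NotBelowF M (2 ^ n) V₂x-nonstd
    , sat-NearF M n (timesT zᵥ b (var xᵥ)) (timesT zᵥ a (var cᵥ))
        (evalT-timesT M b) (evalT-timesT M a) near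
    , sat-PredDivisibleF M {z = zᵥ} {oᵥ} {m} {cᵥ}
        (λ d d+1≡c → c-1-odd-divisible d d+1≡c (suc k)))
  where m = suc (2 * suc k)
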